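{- Let $r$ be a vertex symbol and $\alpha\in\{+,-\}$. Let $\mathcal{A}_\alpha(r)$ be the set of bidirected graphs defined inductively by: (1) every $(-\alpha,-\alpha)$-ditrail that is a simple diear relative to $r$ (i.e., a $(-\alpha,-\alpha)$-ditrail closed over $r$, viewed as a bidirected graph) belongs to $\mathcal{A}_\alpha(r)$; (2) if $G\in\mathcal{A}_\alpha(r)$ and $P$ is a diear relative to $G$ (a diwalk in some bidirected graph having $G$ as a subgraph), then $G+P\in\mathcal{A}_\alpha(r)$. Then $\mathcal{A}_\alpha(r)$ is exactly the set of strong $\alpha$-radials with root $r$.
   Context: A bidirected graph $G$ is a finite graph (loops and parallel edges allowed) with maps $\partial_+,\partial_-:E(G)\to 2^{V(G)}$ such that for each edge $e$ with (possibly identical) ends $u,v$: $\partial_\alpha(e)\subseteq\{u,v\}$, $\partial_+(e)\cup\partial_-(e)=\{u,v\}$, and $\partial_+(e)\cap\partial_-(e)=\emptyset$ if $e$ is not a loop. If $u\in\partial_\alpha(e)$, the sign of $u$ over $e$ is $\alpha$; $-\alpha$ denotes the opposite sign. A walk is a sequence $W=(w_1,\dots,w_k)$, $k$ odd, with $w_i$ a vertex for odd $i$ and $w_i$ an edge joining $w_{i-1},w_{i+1}$ for even $i$; closed over $r$ if $w_1=w_k=r$; a trail has no repeated edge. $W$ is a diwalk if to each traversal of an edge $w_i$ one can assign signs to its end-occurrences equal to the signs of these vertices over $w_i$ (for a loop with one end $+$ and one end $-$, the two assigned signs are distinct), such that at every internal vertex term the signs assigned from the preceding and following edges are distinct. A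 ditrail is a diwalk that is a trail. For $k\ge3$ the sign of $w_1$ (resp. $w_k$) over $W$ is the sign assigned at $w_2$ (resp. $w_{k-1}$); $W$ is an $(\alpha,\beta)$-ditrail if these are $\alpha,\beta$; the trivial ditrail $(v)$ counts as both a $(+,-)$- and a $(-,+)$-ditrail. $G$ is an $\alpha$-radial with root $r$ if every $v$ has an $(\alpha,-\alpha)$-ditrail from $v$ to $r$; it is strong if moreover every $v$ has a $(-\alpha,-\alpha)$-ditrail from $v$ to $r$. For a subgraph $H$, a diear relative to $H$ is a diwalk $W$ whose ends lie in $V(H)$, whose edges are not edges of $H$, and which either (i) is a ditrail (simple diear), or (ii) has the form $(v,e,w_3,\dots,w_{k-2},e,v)$, $k\ge7$, where $e$ joins a vertex of $V(H)$ to a vertex outside $V(H)$ and $(w_3,\dots,w_{k-2})$ is a closed ditrail not containing $e$. A diear relative to $r$ means relative to the graph with the single vertex $r$ and no edges. $H+W$ is $H$ with the vertices and edges of $W$ added. -}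

module Defs where

open import Data.Nat using (ℕ)
open import Data.List using (List; []; _∷_; map; _++_)
open import Data.List.Membership.Propositional using (_∈_; _∉_)
open import Data.List.Relation.Unary.Unique.Propositional using (Unique)
open import Data.Product using (Σ; ∃; ∃-syntax; _×_; _,_)
open import Data.Sum using (_⊎_)
open import Data.Unit using (⊤)
open import Data.Empty using (⊥)
open import Relation.Binary.PropositionalEquality using (_≡_; _≢_)
open import Function.Bundles using (_⇔_)

data Sign : Set where
  plus minus : Sign

-_ : Sign → Sign
- plus  = minus
- minus = plus

-- A graph is given by its (finite) vertex
-- set V, its (finite) edge set E, and the maps ∂₊, ∂₋ : E → 2^V, written
-- ∂ α e (a finite list; only its membership relation matters).

record Graph : Set where
  field
    V : List ℕ
    E : List ℕ
    ∂ : Sign → ℕ → List ℕ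
    ∂⊆V : ∀ {e} → e ∈ E → ∀ α {x} → x ∈ ∂ α e → x ∈ V
    ends : ∀ {e} → e ∈ E → ∃[ u ] ∃[ v ]
             ((∀ x → ((x ∈ ∂ plus e ⊎ x ∈ ∂ minus e) ⇔ (x ≡ u ⊎ x ≡ v)))
              × (u ≢ v → ∀ x → x ∈ ∂ plus e → x ∉ ∂ minus e))

open Graph public

Joins : Graph → ℕ → ℕ → ℕ → Set
Joins G e a b = ∀ x → ((x ∈ ∂ G plus e ⊎ x ∈ ∂ G minus e) ⇔ (x ≡ a ⊎ x ≡ b))

_⊆G_ : Graph → Graph → Set
H ⊆G K = (∀ {v} → v ∈ V H → v ∈ V K)
       × (∀ {e} → e ∈ E H → e ∈ E K)
       × (∀ {e} → e ∈ E H → ∀ α x → (x ∈ ∂ H α e ⇔ x ∈ ∂ K α e))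

-- A walk (w₁, …, w_k) is represented by its
-- first vertex together with the list of steps (w_{2i}, w_{2i+1}); each
-- step also records the signs assigned to the two end-occurrences of the
-- traversed edge (sOut at the vertex left, sIn at the vertex entered).

record Step : Set where
  constructor step
  field
    edge : ℕ
    sOut : Sign
    sIn  : Sign
    to   : ℕ

open Step public

TravOK : Graph → ℕ → ℕ → ℕ → Sign → Sign → Set
TravOK G e a b sa sb =
  (a ∈ ∂ G sa e) × (b ∈ ∂ G sb e)
  × (a ≡ b → a ∈ ∂ G plus e → a ∈ ∂ G minus e → sa ≢ sb)

Compat : Sign → List Step → Set
Compat s []      = ⊤
Compat s (t ∷ _) = s ≢ sOut t

data DiWalk (G : Graph) : ℕ → List Step → Set where
  nil  : ∀ {v} → v ∈ V G → DiWalk G v []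
  cons : ∀ {v e sa sb w ss} → e ∈ E G → Joins G e v w → TravOK G e v w sa sb
       → Compat sb ss → DiWalk G w ss → DiWalk G v (step e sa sb w ∷ ss)

edges : List Step → List ℕ
edges = map edge

lastV : ℕ → List Step → ℕ
lastV v []       = v
lastV v (t ∷ ts) = lastV (to t) ts

verts : ℕ → List Step → List ℕ
verts v ss = v ∷ map to ss

firstSign : List Step → Sign → Set
firstSign []      α = ⊥
firstSign (t ∷ _) α = sOut t ≡ α

lastSignIs : List Step → Sign → Set
lastSignIs []           β = ⊤
lastSignIs (t ∷ [])     β = sIn t ≡ β
lastSignIs (_ ∷ u ∷ ts) β = lastSignIs (u ∷ ts) β

-- (α, β)-sign type of a walk; the trivial walk counts as (+,-) and (-,+)
HasType : List Step → Sign → Sign → Set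
HasType []         α β = β ≡ - α
HasType ss@(_ ∷ _) α β = firstSign ss α × lastSignIs ss β

DiTrail : Graph → Sign → Sign → ℕ → ℕ → List Step → Set
DiTrail G α β v w ss =
  DiWalk G v ss × Unique (edges ss) × lastV v ss ≡ w × HasType ss α β

Radial : Sign → ℕ → Graph → Set
Radial α r G = r ∈ V G × (∀ {v} → v ∈ V G → ∃[ ss ] DiTrail G α (- α) v r ss)

StrongRadial : Sign → ℕ → Graph → Set
StrongRadial α r G =
  Radial α r G × (∀ {v} → v ∈ V G → ∃[ ss ] DiTrail G (- α) (- α) v r ss)

DiEarBase : Graph → Graph → ℕ → List Step → Set
DiEarBase H K v ss =
  DiWalk K v ss × v ∈ V H × lastV v ss ∈ V H
  × (∀ {e} → e ∈ edges ss → e ∉ E H)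

-- (ii) shape: (v, e, w₃, …, w_{k-2}, e, v), k ≥ 7, e joins v ∈ V(H) to
-- w₃ ∉ V(H), and (w₃, …, w_{k-2}) a closed ditrail not containing e
NonSimpleShape : Graph → ℕ → List Step → Set
NonSimpleShape H v ss =
  ∃[ e ] ∃[ s₁ ] ∃[ s₂ ] ∃[ s₃ ] ∃[ s₄ ] ∃[ w₃ ] ∃[ t ] ∃[ mid ]
    (ss ≡ step e s₁ s₂ w₃ ∷ (t ∷ mid) ++ (step e s₃ s₄ v ∷ [])
     × w₃ ∉ V H
     × lastV w₃ (t ∷ mid) ≡ w₃
     × Unique (edges (t ∷ mid))
     × e ∉ edges (t ∷ mid))

DiEar : Graph → Graph → ℕ → List Step → Set
DiEar H K v ss = DiEarBase H K v ss × (Unique (edges ss) ⊎ NonSimpleShape H v ss)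

IsPlus : Graph → Graph → ℕ → List Step → Graph → Set
IsPlus H K v ss G' =
  G' ⊆G K
  × (∀ x → (x ∈ V G' ⇔ (x ∈ V H ⊎ x ∈ verts v ss)))
  × (∀ e → (e ∈ E G' ⇔ (e ∈ E H ⊎ e ∈ edges ss)))

IsWalkGraph : Graph → ℕ → List Step → Graph → Set
IsWalkGraph K v ss G' =
  G' ⊆G K
  × (∀ x → (x ∈ V G' ⇔ x ∈ verts v ss))
  × (∀ e → (e ∈ E G' ⇔ e ∈ edges ss))

data 𝒜 (α : Sign) (r : ℕ) : Graph → Set where
  base : ∀ {K ss G'} → DiTrail K (- α) (- α) r r ss
       → IsWalkGraph K r ss G' → 𝒜 α r G'
  ear  : ∀ {G K v ss G'} → 𝒜 α r G → G ⊆G K → DiEar G K v ss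
       → IsPlus G K v ss G' → 𝒜 α r G'

module Submission where

-- Both directions use the property Rooted: every vertex reaches r by
-- ditrails ending with sign -α, with either first sign.
--
-- Soundness follows by induction
-- on 𝒜: the two halves through a vertex of the base trail end at r, and
-- those through a vertex of an ear end in the old graph, whence they
-- continue to r.  For completeness we grow H ⊆ G from a closed ditrail at
-- r: a missing edge yields a boundary edge g from u ∈ V(H) to z, and a
-- ditrail from z to r, cut where it first re-enters V(H), gives a simple or
-- non-simple diear (EarFinding.ear-exists).  The number of edges of G
-- missing from H decreases, so the process ends with G.

open import Defs
open import Data.Nat using (ℕ; suc; _≤_; _<_; z≤n; s≤s)
open import Data.Nat.Properties using (_≟_; m≤n⇒m≤1+n)
open import Data.Nat.Induction using (<-wellFounded)
open import Induction.WellFounded using (Acc; acc)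
open import Data.List using (List; []; _∷_; map; _++_)
open import Data.List.Properties using (map-++)
open import Data.List.Membership.Propositional using (_∈_; _∉_; find)
open import Data.List.Membership.Propositional.Properties using (∈-++⁺ˡ; ∈-++⁺ʳ; ∈-++⁻; ++-∈⇔)
open import Data.List.Membership.DecPropositional _≟_ using (_∈?_)
open import Data.List.Relation.Unary.Any using (here; there)
open import Data.List.Relation.Unary.All as All using (All; []; _∷_; all?)
open import Data.List.Relation.Unary.All.Properties using (++⁻ˡ; ++⁻ʳ; ¬Any⇒All¬; ¬All⇒Any¬)
open import Data.List.Relation.Unary.AllPairs using ([]; _∷_)
open import Data.List.Relation.Unary.Unique.Propositional using (Unique)
open import Data.List.Relation.Unary.Unique.Propositional.Properties using (++⁺; Unique[x∷xs]⇒x∉xs)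
open import Data.List.Relation.Binary.Disjoint.Propositional using (Disjoint)
open import Data.Product using (∃-syntax; _×_; _,_; proj₁; proj₂)
open import Data.Sum using (_⊎_; inj₁; inj₂; swap)
import Data.Sum as Sum
open import Data.Unit using (⊤; tt)
open import Data.Empty using (⊥-elim)
open import Relation.Nullary using (yes; no)
open import Relation.Binary.PropositionalEquality using (_≡_; _≢_; refl; sym; trans; cong; subst)
open import Function.Bundles using (_⇔_; mk⇔; Equivalence)

open Equivalence using (to; from)

-‿involutive : ∀ σ → - (- σ) ≡ σ
-‿involutive plus  = refl
-‿involutive minus = refl

σ≢-σ : ∀ σ → σ ≢ - σ
σ≢-σ plus  ()
σ≢-σ minus ()

≢⇒≡- : ∀ {σ τ} → σ ≢ τ → σ ≡ - τ
≢⇒≡- {plus}  {plus}  p = ⊥-elim (p refl)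
≢⇒≡- {plus}  {minus} p = refl
≢⇒≡- {minus} {plus}  p = refl
≢⇒≡- {minus} {minus} p = ⊥-elim (p refl)

sign-cases : ∀ σ τ → σ ≡ τ ⊎ σ ≡ - τ
sign-cases plus  plus  = inj₁ refl
sign-cases plus  minus = inj₂ refl
sign-cases minus plus  = inj₂ refl
sign-cases minus minus = inj₁ refl

unique-++⁻ : ∀ {A : Set} (xs : List A) {ys} → Unique (xs ++ ys)
           → Unique xs × Unique ys × Disjoint xs ys
unique-++⁻ []       u          = [] , u , λ { (() , _) }
unique-++⁻ (x ∷ xs) (x∉ ∷ u) with unique-++⁻ xs u
... | uxs , uys , disjoint = ++⁻ˡ xs x∉ ∷ uxs , uys , λ
  { (here refl , y∈ys) → All.lookup (++⁻ʳ xs x∉) y∈ys refl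
  ; (there y∈xs , y∈ys) → disjoint (y∈xs , y∈ys) }

unique-∷ : ∀ {A : Set} {x : A} {xs} → x ∉ xs → Unique xs → Unique (x ∷ xs)
unique-∷ {xs = xs} x∉xs u = ¬Any⇒All¬ xs x∉xs ∷ u

lastV-++ : ∀ v P Q → lastV v (P ++ Q) ≡ lastV (lastV v P) Q
lastV-++ v []      Q = refl
lastV-++ v (t ∷ P) Q = lastV-++ (to t) P Q

∈-edges-++⁻ : ∀ P Q {e} → e ∈ edges (P ++ Q) → e ∈ edges P ⊎ e ∈ edges Q
∈-edges-++⁻ P Q m = ∈-++⁻ (edges P) (subst (_ ∈_) (map-++ edge P Q) m)

∈-edges-++⁺ˡ : ∀ P Q {e} → e ∈ edges P → e ∈ edges (P ++ Q)
∈-edges-++⁺ˡ P Q m = subst (_ ∈_) (sym (map-++ edge P Q)) (∈-++⁺ˡ m)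

∈-edges-++⁺ʳ : ∀ P Q {e} → e ∈ edges Q → e ∈ edges (P ++ Q)
∈-edges-++⁺ʳ P Q m = subst (_ ∈_) (sym (map-++ edge P Q)) (∈-++⁺ʳ (edges P) m)

unique-edges-++⁻ : ∀ P Q → Unique (edges (P ++ Q))
                 → Unique (edges P) × Unique (edges Q) × Disjoint (edges P) (edges Q)
unique-edges-++⁻ P Q u = unique-++⁻ (edges P) (subst Unique (map-++ edge P Q) u)

unique-edges-++⁺ : ∀ P Q → Unique (edges P) → Unique (edges Q) → Disjoint (edges P) (edges Q)
                 → Unique (edges (P ++ Q))
unique-edges-++⁺ P Q uP uQ d = subst Unique (sym (map-++ edge P Q)) (++⁺ uP uQ d)

∈-verts-++⁻ : ∀ w C D {x} → x ∈ verts w (C ++ D) → x ∈ verts w C ⊎ x ∈ map to D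
∈-verts-++⁻ w C D (here refl) = inj₁ (here refl)
∈-verts-++⁻ w C D (there m) with ∈-++⁻ (map to C) (subst (_ ∈_) (map-++ to C D) m)
... | inj₁ m' = inj₁ (there m')
... | inj₂ m' = inj₂ m'

start∈V : ∀ {G v ss} → DiWalk G v ss → v ∈ V G
start∈V     (nil v∈V)                          = v∈V
start∈V {G} (cons {sa = sa} e∈E _ (v∈∂ , _) _ _) = ∂⊆V G e∈E sa v∈∂

walk-edges : ∀ {G v ss} → DiWalk G v ss → ∀ {e} → e ∈ edges ss → e ∈ E G
walk-edges (cons e∈E _ _ _ _) (here refl) = e∈E
walk-edges (cons _ _ _ _ W)   (there m)   = walk-edges W m

walk-verts : ∀ {G v ss} → DiWalk G v ss → ∀ {x} → x ∈ verts v ss → x ∈ V G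
walk-verts W                  (here refl) = start∈V W
walk-verts (cons _ _ _ _ W) (there m)   = walk-verts W m

walk-∂ : ∀ {G v ss} → DiWalk G v ss → ∀ {e} → e ∈ edges ss → ∀ σ {x} → x ∈ ∂ G σ e
       → x ∈ verts v ss
walk-∂ {G} (cons {e = e} _ J _ _ _) (here refl) σ {x} x∈∂ with to (J x) (end σ x∈∂)
  where
  end : ∀ σ → x ∈ ∂ G σ e → x ∈ ∂ G plus e ⊎ x ∈ ∂ G minus e
  end plus  m = inj₁ m
  end minus m = inj₂ m
... | inj₁ refl = here refl
... | inj₂ refl = there (here refl)
walk-∂ (cons _ _ _ _ W) (there m) σ x∈∂ = there (walk-∂ W m σ x∈∂)

lastIn : Step → List Step → Sign
lastIn t []       = sIn t
lastIn t (u ∷ us) = lastIn u us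

lastIn-ok : ∀ t ts → lastSignIs (t ∷ ts) (lastIn t ts)
lastIn-ok t []       = refl
lastIn-ok t (u ∷ us) = lastIn-ok u us

typeOf : ∀ ss → ∃[ σ ] ∃[ τ ] HasType ss σ τ
typeOf []       = plus , minus , refl
typeOf (t ∷ ts) = sOut t , lastIn t ts , refl , lastIn-ok t ts

diwalk-++ : ∀ {G x P Q σ β γ τ} → DiWalk G x P → HasType P σ β
          → DiWalk G (lastV x P) Q → HasType Q γ τ → γ ≡ - β
          → DiWalk G x (P ++ Q) × HasType (P ++ Q) σ τ
diwalk-++ {P = []} {σ = σ} (nil _) refl WQ hQ refl =
  subst (λ s → DiWalk _ _ _ × HasType _ s _) (-‿involutive σ) (WQ , hQ)
diwalk-++ {P = t ∷ []} {Q = []} {β = β} (cons e∈E J T c (nil _)) (f , l) WQ refl refl =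
  cons e∈E J T c WQ , f , trans l (sym (-‿involutive β))
diwalk-++ {P = t ∷ []} {Q = q ∷ qs} {β = β} (cons e∈E J T _ (nil _)) (f , l) WQ (fq , lq) γ≡ =
  cons e∈E J T (λ eq → σ≢-σ β (trans (sym l) (trans eq (trans fq γ≡)))) WQ , f , lq
diwalk-++ {P = t ∷ t' ∷ ps} (cons e∈E J T c W) (f , l) WQ hQ γ≡
  with diwalk-++ {σ = sOut t'} W (refl , l) WQ hQ γ≡
... | W' , (_ , l') = cons e∈E J T c W' , f , l'

split-diwalk : ∀ {G x} P {Q} → DiWalk G x (P ++ Q) → DiWalk G x P × DiWalk G (lastV x P) Q
split-diwalk []      W                  = nil (start∈V W) , W
split-diwalk (t ∷ P) (cons e∈E J T c W) with split-diwalk P W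
... | WP , WQ = cons e∈E J T (compat-prefix P c) WP , WQ
  where
  compat-prefix : ∀ {s} P' {Q'} → Compat s (P' ++ Q') → Compat s P'
  compat-prefix []      _ = tt
  compat-prefix (_ ∷ _) c' = c'

split-type : ∀ {G x} P {Q σ τ} → DiWalk G x (P ++ Q) → HasType (P ++ Q) σ τ
           → ∃[ β ] ∃[ γ ] (HasType P σ β × HasType Q γ τ × γ ≡ - β)
split-type []       {σ = σ} W h = - σ , σ , refl , h , sym (-‿involutive σ)
split-type (t ∷ []) {[]}     W (f , l) =
  sIn t , - sIn t , (f , refl) , trans (sym l) (sym (-‿involutive (sIn t))) , refl
split-type (t ∷ []) {q ∷ qs} (cons _ _ _ c _) (f , l) =
  sIn t , sOut q , (f , refl) , (refl , l) , ≢⇒≡- (λ eq → c (sym eq))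
split-type (t ∷ t' ∷ ps) {Q} (cons _ _ _ _ W) (f , l)
  with split-type (t' ∷ ps) {Q} {σ = sOut t'} W (refl , l)
... | β , γ , (_ , lP) , hQ , γ≡ = β , γ , (f , lP) , hQ , γ≡

joins-sym : ∀ {G e a b} → Joins G e a b → Joins G e b a
joins-sym J x = mk⇔ (λ m → swap (to (J x) m)) (λ m → from (J x) (swap m))

trav-sym : ∀ {G e a b sa sb} → TravOK G e a b sa sb → TravOK G e b a sb sa
trav-sym (a∈ , b∈ , loop) = b∈ , a∈ , λ { refl p m eq → loop refl p m (sym eq) }

rev : ℕ → List Step → List Step
rev x []                  = []
rev x (step e a b w ∷ ss) = rev w ss ++ (step e b a x ∷ [])

rev-diwalk : ∀ {G x ss σ β} → DiWalk G x ss → HasType ss σ β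
           → DiWalk G (lastV x ss) (rev x ss) × HasType (rev x ss) β σ
             × lastV (lastV x ss) (rev x ss) ≡ x
rev-diwalk {ss = []} {σ = σ} (nil m) refl = nil m , sym (-‿involutive σ) , refl
rev-diwalk {G} {ss = step e a b w ∷ []} W@(cons e∈E J T _ (nil _)) (refl , refl) =
  cons e∈E (joins-sym {G} J) (trav-sym {G} T) tt (nil (start∈V W)) , (refl , refl) , refl
rev-diwalk {G} {x} {ss = step e a b w ∷ t' ∷ ps} {β = β} W@(cons e∈E J T c W') (refl , l)
  with rev-diwalk {σ = sOut t'} W' (refl , l)
... | Wr , hr , back =
  proj₁ glued , proj₂ glued ,
  trans (lastV-++ (lastV w (t' ∷ ps)) (rev w (t' ∷ ps)) _) (cong (λ y → lastV y lastStep) back)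
  where
  lastStep : List Step
  lastStep = step e b a x ∷ []
  Wlast : DiWalk G (lastV (lastV w (t' ∷ ps)) (rev w (t' ∷ ps))) lastStep
  Wlast = subst (λ y → DiWalk G y lastStep) (sym back)
                (cons e∈E (joins-sym {G} J) (trav-sym {G} T) tt (nil (start∈V W)))
  glued : DiWalk G (lastV w (t' ∷ ps)) (rev w (t' ∷ ps) ++ lastStep)
          × HasType (rev w (t' ∷ ps) ++ lastStep) β a
  glued = diwalk-++ Wr hr Wlast (refl , refl) (≢⇒≡- c)

rev-edges : ∀ x ss {e} → e ∈ edges (rev x ss) → e ∈ edges ss
rev-edges x (step e a b w ∷ ss) m with ∈-edges-++⁻ (rev w ss) _ m
... | inj₁ m'          = there (rev-edges w ss m')
... | inj₂ (here refl) = here refl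

rev-unique : ∀ x ss → Unique (edges ss) → Unique (edges (rev x ss))
rev-unique x []                  u = u
rev-unique x (step e a b w ∷ ss) u@(_ ∷ uss) =
  unique-edges-++⁺ (rev w ss) _ (rev-unique w ss uss) ([] ∷ [])
    (λ { (m , here refl) → Unique[x∷xs]⇒x∉xs u (rev-edges w ss m) })

transfer-diwalk : ∀ {G K v ss}
  → (∀ {e} → e ∈ edges ss → e ∈ E K × (∀ σ x → (x ∈ ∂ G σ e ⇔ x ∈ ∂ K σ e)))
  → (∀ {x} → x ∈ verts v ss → x ∈ V K) → DiWalk G v ss → DiWalk K v ss
transfer-diwalk eh vh (nil _) = nil (vh (here refl))
transfer-diwalk {G} {K} {v} eh vh (cons {e = e} {w = w} _ J (a∈ , b∈ , loop) c W) =
  cons (proj₁ (eh (here refl))) J' (to (I _ _) a∈ , to (I _ _) b∈ ,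
        λ eq p m → loop eq (from (I _ _) p) (from (I _ _) m)) c
       (transfer-diwalk (λ m → eh (there m)) (λ m → vh (there m)) W)
  where
  I : ∀ σ x → (x ∈ ∂ G σ e ⇔ x ∈ ∂ K σ e)
  I = proj₂ (eh (here refl))
  J' : Joins K e v w
  J' x = mk⇔ (λ m → to (J x) (Sum.map (from (I _ _)) (from (I _ _)) m))
             (λ m → Sum.map (to (I _ _)) (to (I _ _)) (from (J x) m))

sub-diwalk : ∀ {H K v ss} → H ⊆G K → DiWalk H v ss → DiWalk K v ss
sub-diwalk (sv , se , s∂) W =
  transfer-diwalk (λ m → se (walk-edges W m) , s∂ (walk-edges W m)) (λ m → sv (walk-verts W m)) W

restrict-diwalk : ∀ {H K v ss} → H ⊆G K → (∀ {x} → x ∈ verts v ss → x ∈ V H)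
                → (∀ {e} → e ∈ edges ss → e ∈ E H) → DiWalk K v ss → DiWalk H v ss
restrict-diwalk (_ , _ , s∂) vh eh =
  transfer-diwalk (λ m → eh m , λ σ x → mk⇔ (from (s∂ (eh m) σ x)) (to (s∂ (eh m) σ x))) vh

trail-mono : ∀ {H K σ τ x y ss} → H ⊆G K → DiTrail H σ τ x y ss → DiTrail K σ τ x y ss
trail-mono s (W , u , l , h) = sub-diwalk s W , u , l , h

ditrail-++ : ∀ {G σ β γ τ x y z P Q} → DiTrail G σ β x y P → DiTrail G γ τ y z Q → γ ≡ - β
           → Disjoint (edges P) (edges Q) → DiTrail G σ τ x z (P ++ Q)
ditrail-++ {G} {x = x} {P = P} {Q} (WP , uP , lP , hP) (WQ , uQ , lQ , hQ) γ≡ d =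
  proj₁ glued , unique-edges-++⁺ P Q uP uQ d ,
  trans (lastV-++ x P Q) (trans (cong (λ a → lastV a Q) lP) lQ) , proj₂ glued
  where
  glued = diwalk-++ WP hP (subst (λ a → DiWalk G a Q) (sym lP) WQ) hQ γ≡

split-at-vertex : ∀ v ss {x} → x ∈ verts v ss
                → ∃[ pre ] ∃[ post ] (ss ≡ pre ++ post × lastV v pre ≡ x)
split-at-vertex v ss       (here refl) = [] , ss , refl , refl
split-at-vertex v (t ∷ ts) (there m) with split-at-vertex (to t) ts m
... | pre , post , refl , l = t ∷ pre , post , refl , l

-- A ditrail through x yields two ditrails starting at x with opposite first
-- signs: the rest of the trail, and the reversed initial segment.  This is
-- the basic source of the two ditrails required of a strong radial.
opposite-trails : ∀ {G a b σ τ} pre post → DiTrail G σ τ a b (pre ++ post)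
                → ∃[ β ] (DiTrail G (- β) τ (lastV a pre) b post
                          × DiTrail G β σ (lastV a pre) a (rev a pre))
opposite-trails {G} {a} pre post (W , u , l , h)
  with split-type pre W h | split-diwalk pre W
... | β , γ , hpre , hpost , γ≡ | Wpre , Wpost with rev-diwalk Wpre hpre
... | Wr , hr , lr with unique-edges-++⁻ pre post u
... | upre , upost , _ =
  β , (Wpost , upost , trans (sym (lastV-++ a pre post)) l , subst (λ s → HasType post s _) γ≡ hpost)
    , (Wr , rev-unique a pre upre , lr , hr)

TrailWithin : Graph → Sign → Sign → ℕ → ℕ → List ℕ → Set
TrailWithin G σ τ x y A = ∃[ ss ] (DiTrail G σ τ x y ss × (∀ {e} → e ∈ edges ss → e ∈ A))

through-vertex : ∀ {G σ τ a b ss x} → DiTrail G σ τ a b ss → x ∈ verts a ss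
               → ∃[ β ] (TrailWithin G (- β) τ x b (edges ss) × TrailWithin G β σ x a (edges ss))
through-vertex {a = a} {ss = ss} T x∈ with split-at-vertex a ss x∈
... | pre , post , refl , refl with opposite-trails pre post T
... | β , T₁ , T₂ = β , (post , T₁ , ∈-edges-++⁺ʳ pre post)
                      , (rev a pre , T₂ , λ m → ∈-edges-++⁺ˡ pre post (rev-edges a pre m))

append-trail : ∀ {G σ τ ρ x w y A B} → TrailWithin G σ (- τ) x w A → DiTrail G τ ρ w y B
             → Disjoint A (edges B) → TrailWithin G σ ρ x y (A ++ edges B)
append-trail {τ = τ} {A = A} {B} (P , T , P⊆A) TB d =
  P ++ B , ditrail-++ T TB (sym (-‿involutive τ)) (λ { (m , m') → d (P⊆A m , m') }) ,
  λ m → case (∈-edges-++⁻ P B m)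
  where
  case : ∀ {e} → e ∈ edges P ⊎ e ∈ edges B → e ∈ A ++ edges B
  case (inj₁ m) = ∈-++⁺ˡ (P⊆A m)
  case (inj₂ m) = ∈-++⁺ʳ A m

sign-unique : ∀ {K e a b s s'} → e ∈ E K → Joins K e a b → a ≢ b
            → a ∈ ∂ K s e → a ∈ ∂ K s' e → s ≡ s'
sign-unique {K} {e} {a} {b} {s} {s'} e∈E J a≢b a∈s a∈s' with ends K e∈E
... | u , u' , I , disjoint = signs s s' a∈s a∈s'
  where
  same-end : ∀ {x y} → x ≡ u ⊎ x ≡ u' → y ≡ u ⊎ y ≡ u' → u ≡ u' → x ≡ y
  same-end (inj₁ p) (inj₁ q) _  = trans p (sym q)
  same-end (inj₁ p) (inj₂ q) eq = trans p (trans eq (sym q))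
  same-end (inj₂ p) (inj₁ q) eq = trans p (trans (sym eq) (sym q))
  same-end (inj₂ p) (inj₂ q) _  = trans p (sym q)
  u≢u' : u ≢ u'
  u≢u' eq = a≢b (same-end (to (I a) (from (J a) (inj₁ refl))) (to (I b) (from (J b) (inj₂ refl))) eq)
  signs : ∀ s s' → a ∈ ∂ K s e → a ∈ ∂ K s' e → s ≡ s'
  signs plus  plus  _ _ = refl
  signs minus minus _ _ = refl
  signs plus  minus p m = ⊥-elim (disjoint u≢u' a p m)
  signs minus plus  m p = ⊥-elim (disjoint u≢u' a p m)

nonsimple-parts : ∀ {G v e s₁ s₂ s₃ s₄ w₃} t mid → let C = t ∷ mid ; B = step e s₃ s₄ v ∷ [] in
                  DiWalk G v (step e s₁ s₂ w₃ ∷ C ++ B) → lastV w₃ C ≡ w₃ → Unique (edges C) → v ≢ w₃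
                → DiTrail G (- s₂) (- s₂) w₃ w₃ C × DiTrail G s₂ s₄ w₃ v B
nonsimple-parts {G} {v} {e} {s₁} {s₂} {s₃} {s₄} {w₃} t mid (cons _ _ (_ , w₃∈s₂ , _) c WCB) closed uC v≢w₃
  with split-diwalk (t ∷ mid) WCB | typeOf ((t ∷ mid) ++ step e s₃ s₄ v ∷ [])
... | WC , WB | _ , _ , h with split-type (t ∷ mid) WCB h
... | β , γ , (_ , last) , (s₃≡γ , _) , γ≡ with subst (λ y → DiWalk G y (step e s₃ s₄ v ∷ [])) closed WB
... | WB'@(cons e∈E J (w₃∈s₃ , _) _ _) =
  (WC , uC , closed , (≢⇒≡- (λ eq → c (sym eq)) , subst (lastSignIs (t ∷ mid)) β≡-s₂ last)) ,
  (WB' , [] ∷ [] , refl , (s₃≡s₂ , refl))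
  where
  s₃≡s₂ : s₃ ≡ s₂
  s₃≡s₂ = sign-unique {G} e∈E J (λ eq → v≢w₃ (sym eq)) w₃∈s₃ w₃∈s₂
  β≡-s₂ : β ≡ - s₂
  β≡-s₂ = trans (sym (-‿involutive β)) (cong -_ (trans (sym γ≡) (trans (sym s₃≡γ) s₃≡s₂)))

Reaches : Sign → ℕ → Graph → ℕ → Set
Reaches α r G v = ∀ σ → ∃[ ss ] DiTrail G σ (- α) v r ss

Rooted : Sign → ℕ → Graph → Set
Rooted α r G = r ∈ V G × (∀ {v} → v ∈ V G → Reaches α r G v)

rooted⇒strong : ∀ {α r G} → Rooted α r G → StrongRadial α r G
rooted⇒strong {α} (r∈V , R) = (r∈V , λ m → R m α) , λ m → R m (- α)

strong⇒reaches : ∀ {α r G} → StrongRadial α r G → ∀ {v} → v ∈ V G → Reaches α r G v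
strong⇒reaches {α} ((_ , R₊) , R₋) m σ with sign-cases σ α
... | inj₁ refl = R₊ m
... | inj₂ refl = R₋ m

⊆-plus : ∀ {G K v ss G'} → G ⊆G K → IsPlus G K v ss G' → G ⊆G G'
⊆-plus (_ , _ , s∂) ((_ , _ , s∂') , vI , eI) =
  (λ m → from (vI _) (inj₁ m)) , (λ m → from (eI _) (inj₁ m)) ,
  λ e∈G σ x → let e∈G' = from (eI _) (inj₁ e∈G)
              in mk⇔ (λ p → from (s∂' e∈G' σ x) (to (s∂ e∈G σ x) p))
                     (λ p → from (s∂ e∈G σ x) (to (s∂' e∈G' σ x) p))

walk-in-plus : ∀ {G K v ss G'} → DiWalk K v ss → IsPlus G K v ss G' → DiWalk G' v ss
walk-in-plus W (sub , vI , eI) =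
  restrict-diwalk sub (λ m → from (vI _) (inj₂ m)) (λ m → from (eI _) (inj₂ m)) W

module Soundness (α : Sign) (r : ℕ) where

  reaches-mono : ∀ {H K v} → H ⊆G K → Reaches α r H v → Reaches α r K v
  reaches-mono s R σ with R σ
  ... | ss , T = ss , trail-mono s T

  both-signs : ∀ {G x} β → (∃[ ss ] DiTrail G (- β) (- α) x r ss)
             → (∃[ ss ] DiTrail G β (- α) x r ss) → Reaches α r G x
  both-signs β T₋ T₊ σ with sign-cases σ β
  ... | inj₁ refl = T₊
  ... | inj₂ refl = T₋

  continue : ∀ {G G' σ τ x b A} → G ⊆G G' → Rooted α r G → TrailWithin G' σ τ x b A
           → b ∈ V G → (∀ {e} → e ∈ A → e ∉ E G) → ∃[ ss ] DiTrail G' σ (- α) x r ss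
  continue {τ = τ} s (_ , R) (P , T , P⊆A) b∈G new with R b∈G (- τ)
  ... | Q , TQ = P ++ Q , ditrail-++ T (trail-mono s TQ) refl
                            (λ { (m , m') → new (P⊆A m) (walk-edges (proj₁ TQ) m') })

  continue-both : ∀ {G G' x a b τ τ' A} β → G ⊆G G' → Rooted α r G
                → TrailWithin G' (- β) τ x a A → TrailWithin G' β τ' x b A
                → a ∈ V G → b ∈ V G → (∀ {e} → e ∈ A → e ∉ E G) → Reaches α r G' x
  continue-both β s gd T₁ T₂ a∈G b∈G new =
    both-signs β (continue s gd T₁ a∈G new) (continue s gd T₂ b∈G new)

  base-rooted : ∀ {K ss G'} → DiTrail K (- α) (- α) r r ss → IsWalkGraph K r ss G' → Rooted α r G'
  base-rooted {K} {ss} {G'} (W , u , l , h) (sub , vI , eI) = from (vI r) (here refl) , R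
    where
    T : DiTrail G' (- α) (- α) r r ss
    T = restrict-diwalk sub (λ m → from (vI _) m) (λ m → from (eI _) m) W , u , l , h
    R : ∀ {x} → x ∈ V G' → Reaches α r G' x
    R {x} m with through-vertex T (to (vI x) m)
    ... | β , (P₁ , T₁ , _) , (P₂ , T₂ , _) = both-signs β (P₁ , T₁) (P₂ , T₂)

  -- adding a simple diear: its vertices reach both ends of the ear
  simple-ear-rooted : ∀ {G K v ss G'} → Rooted α r G → G ⊆G K → DiEarBase G K v ss
                    → Unique (edges ss) → IsPlus G K v ss G' → Rooted α r G'
  simple-ear-rooted {G} {K} {v} {ss} {G'} gd@(r∈G , R) sub (W , v∈G , end∈G , new) u ip@(_ , vI , _) =
    proj₁ s r∈G , R'
    where
    s : G ⊆G G'
    s = ⊆-plus {G} {K} {v} {ss} {G'} sub ip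
    R' : ∀ {x} → x ∈ V G' → Reaches α r G' x
    R' {x} m with to (vI x) m | typeOf ss
    ... | inj₁ x∈G | _ = reaches-mono s (R x∈G)
    ... | inj₂ x∈ss | σ , τ , h with through-vertex (walk-in-plus {G} W ip , u , refl , h) x∈ss
    ... | β , T₁ , T₂ = continue-both β s gd T₁ T₂ end∈G v∈G new

  -- adding a non-simple diear (v, e, C, e, v): a vertex of the closed
  -- ditrail C reaches w₃ both ways along C and then leaves through e
  nonsimple-ear-rooted : ∀ {G K v ss G'} → Rooted α r G → G ⊆G K → DiEarBase G K v ss
                       → NonSimpleShape G v ss → IsPlus G K v ss G' → Rooted α r G'
  nonsimple-ear-rooted {G} {K} {v} {G' = G'} gd@(r∈G , R) sub (W , v∈G , _ , new)
      (e , s₁ , s₂ , s₃ , s₄ , w₃ , t , mid , refl , w₃∉G , closedC , uC , e∉C) ip@(_ , vI , _) =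
    proj₁ s r∈G , R'
    where
    C B : List Step
    C = t ∷ mid
    B = step e s₃ s₄ v ∷ []
    s : G ⊆G G'
    s = ⊆-plus {G} {K} {v} {step e s₁ s₂ w₃ ∷ C ++ B} {G'} sub ip
    new-CB : ∀ {e'} → e' ∈ edges C ++ edges B → e' ∉ E G
    new-CB m with ∈-++⁻ (edges C) m
    ... | inj₁ m' = new (there (∈-edges-++⁺ˡ C B m'))
    ... | inj₂ (here refl) = new (here refl)
    around : DiTrail G' (- s₂) (- s₂) w₃ w₃ C × DiTrail G' s₂ s₄ w₃ v B
    around = nonsimple-parts t mid (walk-in-plus {G} W ip) closedC uC
                             (λ eq → w₃∉G (subst (_∈ V G) eq v∈G))
    on-C : ∀ {x} → x ∈ verts w₃ C → Reaches α r G' x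
    on-C x∈C with through-vertex (proj₁ around) x∈C
    ... | β , T₁ , T₂ = continue-both β s gd (exit T₁) (exit T₂) v∈G v∈G new-CB
      where
      e∉C' : Disjoint (edges C) (edges B)
      e∉C' (m , here refl) = e∉C m
      exit : ∀ {σ} → TrailWithin G' σ (- s₂) _ w₃ (edges C) → TrailWithin G' σ s₄ _ v (edges C ++ edges B)
      exit T = append-trail T (proj₂ around) e∉C'
    R' : ∀ {x} → x ∈ V G' → Reaches α r G' x
    R' {x} m with to (vI x) m
    ... | inj₁ x∈G         = reaches-mono s (R x∈G)
    ... | inj₂ (here refl) = reaches-mono s (R v∈G)
    ... | inj₂ (there m') with ∈-verts-++⁻ w₃ C B m'
    ... | inj₁ x∈C         = on-C x∈C
    ... | inj₂ (here refl) = reaches-mono s (R v∈G)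

  soundness : ∀ {G} → 𝒜 α r G → Rooted α r G
  soundness (base T IW)               = base-rooted T IW
  soundness (ear A sub (D , inj₁ u) ip)  = simple-ear-rooted (soundness A) sub D u ip
  soundness (ear A sub (D , inj₂ ns) ip) = nonsimple-ear-rooted (soundness A) sub D ns ip

orientation : ∀ {G g u z p y} → Joins G g u z → u ≢ z → Joins G g p y
            → (p ≡ u × y ≡ z) ⊎ (p ≡ z × y ≡ u)
orientation {u = u} {z} {p} {y} J u≢z J' with to (J p) (from (J' p) (inj₁ refl)) | to (J y) (from (J' y) (inj₂ refl))
... | inj₁ p≡u  | inj₂ y≡z  = inj₁ (p≡u , y≡z)
... | inj₂ p≡z  | inj₁ y≡u  = inj₂ (p≡z , y≡u)
... | inj₁ refl | inj₁ refl with to (J' z) (from (J z) (inj₂ refl))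
...   | inj₁ z≡p = ⊥-elim (u≢z (sym z≡p))
...   | inj₂ z≡y = ⊥-elim (u≢z (sym z≡y))
orientation {u = u} J u≢z J' | inj₂ refl | inj₂ refl with to (J' u) (from (J u) (inj₁ refl))
...   | inj₁ u≡p = ⊥-elim (u≢z u≡p)
...   | inj₂ u≡y = ⊥-elim (u≢z u≡y)

end-sign : ∀ {G g x} → x ∈ ∂ G plus g ⊎ x ∈ ∂ G minus g → ∃[ σ ] x ∈ ∂ G σ g
end-sign (inj₁ p) = plus , p
end-sign (inj₂ m) = minus , m

traversal : ∀ {G g u z} → Joins G g u z → ∃[ s ] ∃[ t ] TravOK G g u z s t
traversal {G} {g} {u} {z} J with from (J u) (inj₁ refl) | from (J z) (inj₂ refl) | u ≟ z
... | u∈ | z∈ | no u≢z with end-sign {G} u∈ | end-sign {G} z∈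
...   | s , u∈s | t , z∈t = s , t , u∈s , z∈t , λ u≡z → ⊥-elim (u≢z u≡z)
traversal {G} {g} {u} J | u∈ | _ | yes refl with u ∈? ∂ G plus g | u ∈? ∂ G minus g
... | yes p  | yes m  = plus , minus , p , m , λ _ _ _ ()
... | yes p  | no ¬m  = plus , plus , p , p , λ _ _ m → ⊥-elim (¬m m)
... | no ¬p  | yes m  = minus , minus , m , m , λ _ p _ → ⊥-elim (¬p p)
... | no ¬p  | no ¬m  with u∈
...   | inj₁ p = ⊥-elim (¬p p)
...   | inj₂ m = ⊥-elim (¬m m)

walk-graph : (G : Graph) → ∀ v ss → DiWalk G v ss → Graph
walk-graph G v ss W = record
  { V = verts v ss ; E = edges ss ; ∂ = ∂ G
  ; ∂⊆V = walk-∂ W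
  ; ends = λ m → ends G (walk-edges W m) }

walk-graph-ok : ∀ G v ss (W : DiWalk G v ss) → IsWalkGraph G v ss (walk-graph G v ss W)
walk-graph-ok G v ss W =
  (walk-verts W , walk-edges W , λ _ _ _ → mk⇔ (λ p → p) (λ p → p)) ,
  (λ _ → mk⇔ (λ p → p) (λ p → p)) , (λ _ → mk⇔ (λ p → p) (λ p → p))

plus-graph : (H G : Graph) → H ⊆G G → ∀ v ss → DiWalk G v ss → Graph
plus-graph H G (_ , se , s∂) v ss W = record
  { V = V H ++ verts v ss ; E = E H ++ edges ss ; ∂ = ∂ G
  ; ∂⊆V = ends∈V
  ; ends = λ m → ends G (edge∈G m) }
  where
  ends∈V : ∀ {e} → e ∈ E H ++ edges ss → ∀ σ {x} → x ∈ ∂ G σ e → x ∈ V H ++ verts v ss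
  ends∈V m σ x∈ with ∈-++⁻ (E H) m
  ... | inj₁ e∈H = ∈-++⁺ˡ (∂⊆V H e∈H σ (from (s∂ e∈H σ _) x∈))
  ... | inj₂ e∈W = ∈-++⁺ʳ (V H) (walk-∂ W e∈W σ x∈)
  edge∈G : ∀ {e} → e ∈ E H ++ edges ss → e ∈ E G
  edge∈G m with ∈-++⁻ (E H) m
  ... | inj₁ e∈H = se e∈H
  ... | inj₂ e∈W = walk-edges W e∈W

plus-graph-ok : ∀ H G (s : H ⊆G G) v ss (W : DiWalk G v ss) → IsPlus H G v ss (plus-graph H G s v ss W)
plus-graph-ok H G (sv , se , _) v ss W =
  (vertex∈G , edge∈G , λ _ _ _ → mk⇔ (λ p → p) (λ p → p)) , (λ _ → ++-∈⇔) , (λ _ → ++-∈⇔)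
  where
  vertex∈G : ∀ {x} → x ∈ V H ++ verts v ss → x ∈ V G
  vertex∈G m with ∈-++⁻ (V H) m
  ... | inj₁ x∈H = sv x∈H
  ... | inj₂ x∈W = walk-verts W x∈W
  edge∈G : ∀ {e} → e ∈ E H ++ edges ss → e ∈ E G
  edge∈G m with ∈-++⁻ (E H) m
  ... | inj₁ e∈H = se e∈H
  ... | inj₂ e∈W = walk-edges W e∈W

⊆-same : ∀ {H G K} → H ⊆G K → H ⊆G G → (∀ {v} → v ∈ V G → v ∈ V H)
       → (∀ {e} → e ∈ E G → e ∈ E H) → G ⊆G K
⊆-same (kv , ke , k∂) (_ , _ , g∂) bv be =
  (λ m → kv (bv m)) , (λ m → ke (be m)) ,
  λ e∈G σ x → let e∈H = be e∈G
              in mk⇔ (λ p → to (k∂ e∈H σ x) (from (g∂ e∈H σ x) p))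
                     (λ p → to (g∂ e∈H σ x) (from (k∂ e∈H σ x) p))

same-V : ∀ {H G} {P : ℕ → Set} → (∀ x → x ∈ V H ⇔ P x) → H ⊆G G
       → (∀ {v} → v ∈ V G → v ∈ V H) → ∀ x → x ∈ V G ⇔ P x
same-V I (sv , _ , _) bv x = mk⇔ (λ m → to (I x) (bv m)) (λ p → sv (from (I x) p))

same-E : ∀ {H G} {P : ℕ → Set} → (∀ e → e ∈ E H ⇔ P e) → H ⊆G G
       → (∀ {e} → e ∈ E G → e ∈ E H) → ∀ e → e ∈ E G ⇔ P e
same-E I (_ , se , _) be e = mk⇔ (λ m → to (I e) (be m)) (λ p → se (from (I e) p))

𝒜-resp-same : ∀ {α r H G} → 𝒜 α r H → H ⊆G G → (∀ {v} → v ∈ V G → v ∈ V H)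
            → (∀ {e} → e ∈ E G → e ∈ E H) → 𝒜 α r G
𝒜-resp-same {H = H} {G} (base {K = K} T (sk , vI , eI)) s bv be =
  base T (⊆-same {H} {G} {K} sk s bv be , same-V {H} {G} vI s bv , same-E {H} {G} eI s be)
𝒜-resp-same {H = H} {G} (ear {K = K} A s₀ D (sk , vI , eI)) s bv be =
  ear A s₀ D (⊆-same {H} {G} {K} sk s bv be , same-V {H} {G} vI s bv , same-E {H} {G} eI s be)

split-at-edge : ∀ ss {e} → e ∈ edges ss
              → ∃[ pre ] ∃[ a ] ∃[ b ] ∃[ y ] ∃[ post ] (ss ≡ pre ++ step e a b y ∷ post)
split-at-edge (step e a b y ∷ ss) (here refl) = [] , a , b , y , ss , refl
split-at-edge (t ∷ ss) (there m) with split-at-edge ss m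
... | pre , a , b , y , post , refl = t ∷ pre , a , b , y , post , refl

module EarFinding (H G : Graph) (H⊆G : H ⊆G G) where

  NewEar : Set
  NewEar = ∃[ u ] ∃[ t ] ∃[ ss ] DiEar H G u (t ∷ ss)

  BoundaryEdge : Set
  BoundaryEdge = ∃[ g ] ∃[ u ] ∃[ z ] (g ∈ E G × g ∉ E H × u ∈ V H × Joins G g u z)

  separated : ∀ {u z} → u ∈ V H → z ∉ V H → u ≢ z
  separated u∈H z∉H refl = z∉H u∈H

  leaves-outside : ∀ {e a b sa sb} → TravOK G e a b sa sb → a ∉ V H → e ∉ E H
  leaves-outside {sa = sa} (a∈ , _ , _) a∉H e∈H =
    a∉H (∂⊆V H e∈H sa (from (proj₂ (proj₂ H⊆G) e∈H sa _) a∈))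

  Outside : List Step → Set
  Outside = All (λ q → to q ∉ V H)

  InteriorOutside : List Step → Set
  InteriorOutside []            = ⊤
  InteriorOutside (_ ∷ [])      = ⊤
  InteriorOutside (q ∷ q' ∷ qs) = to q ∉ V H × InteriorOutside (q' ∷ qs)

  interior-outside-new : ∀ {x ss} → DiWalk G x ss → x ∉ V H → InteriorOutside ss
                       → ∀ {e} → e ∈ edges ss → e ∉ E H
  interior-outside-new (cons _ _ Tr _ _) x∉H _ (here refl) = leaves-outside Tr x∉H
  interior-outside-new {ss = _ ∷ _ ∷ _} (cons _ _ _ _ W) _ (y∉H , io) (there m) =
    interior-outside-new W y∉H io m

  outside-new : ∀ {x ss} → DiWalk G x ss → x ∉ V H → Outside ss → ∀ {e} → e ∈ edges ss → e ∉ E H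
  outside-new (cons _ _ Tr _ _) x∉H _           (here refl) = leaves-outside Tr x∉H
  outside-new (cons _ _ _ _ W)  _   (y∉H ∷ out) (there m)   = outside-new W y∉H out m

  outside-end : ∀ x ss → x ∉ V H → Outside ss → lastV x ss ∉ V H
  outside-end x []       x∉H []          = x∉H
  outside-end x (q ∷ qs) _   (y∉H ∷ out) = outside-end (to q) qs y∉H out

  first-entry : ∀ x ss
              → (∃[ q ] ∃[ qs ] ∃[ post ] (ss ≡ (q ∷ qs) ++ post × lastV x (q ∷ qs) ∈ V H
                                            × InteriorOutside (q ∷ qs)))
                ⊎ Outside ss
  first-entry x []       = inj₂ []
  first-entry x (q ∷ qs) with to q ∈? V H
  ... | yes y∈H = inj₁ (q , [] , qs , refl , y∈H , tt)
  ... | no y∉H with first-entry (to q) qs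
  ...   | inj₁ (q' , qs' , post , refl , end∈H , io) = inj₁ (q , q' ∷ qs' , post , refl , end∈H , (y∉H , io))
  ...   | inj₂ out = inj₂ (y∉H ∷ out)

  reenter-or-stay : ∀ {u z g s t} rest → u ∈ V H → z ∉ V H → g ∉ E H
                  → DiWalk G u (step g s t z ∷ rest) → Unique (edges (step g s t z ∷ rest))
                  → NewEar ⊎ Outside rest
  reenter-or-stay {u} {z} {g} {s} {t} rest u∈H z∉H g∉H (cons g∈G J Tr c W) uq with first-entry z rest
  ... | inj₂ out = inj₂ out
  ... | inj₁ (q , qs , post , refl , end∈H , io) =
    inj₁ (u , step g s t z , q ∷ qs ,
          (cons g∈G J Tr c Wpre , u∈H , end∈H , new) ,
          inj₁ (proj₁ (unique-edges-++⁻ (step g s t z ∷ q ∷ qs) post uq)))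
    where
    Wpre : DiWalk G z (q ∷ qs)
    Wpre = proj₁ (split-diwalk (q ∷ qs) W)
    new : ∀ {e} → e ∈ edges (step g s t z ∷ q ∷ qs) → e ∉ E H
    new (here refl) = g∉H
    new (there m)   = interior-outside-new Wpre z∉H io m

  trail-ear : ∀ {u z g s t} rest → u ∈ V H → z ∉ V H → g ∉ E H
            → DiWalk G u (step g s t z ∷ rest) → Unique (edges (step g s t z ∷ rest))
            → lastV z rest ∈ V H → NewEar
  trail-ear rest u∈H z∉H g∉H W uq end∈H with reenter-or-stay rest u∈H z∉H g∉H W uq
  ... | inj₁ found = found
  ... | inj₂ out = ⊥-elim (outside-end _ rest z∉H out end∈H)

  -- Leaving V(H) through g from u to z, followed by a (-t,-t)-ditrail C
  -- closed over z and avoiding g: either C re-enters V(H), or C stays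
  -- outside and (u, g, C, g, u) is a non-simple diear.
  closed-ear : ∀ {u z g s t} C → g ∈ E G → Joins G g u z → TravOK G g u z s t
             → u ∈ V H → z ∉ V H → g ∉ E H
             → DiWalk G z C → HasType C (- t) (- t) → lastV z C ≡ z
             → Unique (edges C) → g ∉ edges C → NewEar
  closed-ear {t = t} [] _ _ _ _ _ _ _ hC _ _ _ = ⊥-elim (σ≢-σ (- t) hC)
  closed-ear {u} {z} {g} {s} {t} C@(q ∷ qs) g∈G J Tr u∈H z∉H g∉H WC hC closed uC g∉C
    with reenter-or-stay C u∈H z∉H g∉H (leave WC) (unique-∷ g∉C uC)
    where
    leave : DiWalk G z C → DiWalk G u (step g s t z ∷ C)
    leave = cons g∈G J Tr (λ eq → σ≢-σ t (trans eq (proj₁ hC)))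
  ... | inj₁ found = found
  ... | inj₂ out = u , step g s t z , C ++ back , (walk , u∈H , end∈H , new) , inj₂ shape
    where
    back : List Step
    back = step g t s u ∷ []
    Wback : DiWalk G (lastV z C) back
    Wback = subst (λ w → DiWalk G w back) (sym closed)
                  (cons g∈G (joins-sym {G} J) (trav-sym {G} Tr) tt (nil (proj₁ H⊆G u∈H)))
    walk : DiWalk G u (step g s t z ∷ C ++ back)
    walk = cons g∈G J Tr (λ eq → σ≢-σ t (trans eq (proj₁ hC)))
                (proj₁ (diwalk-++ WC hC Wback (refl , refl) (sym (-‿involutive t))))
    end∈H : lastV z (C ++ back) ∈ V H
    end∈H = subst (_∈ V H) (sym (lastV-++ z C back)) u∈H
    new : ∀ {e} → e ∈ edges (step g s t z ∷ C ++ back) → e ∉ E H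
    new (here refl) = g∉H
    new (there m) with ∈-edges-++⁻ C back m
    ... | inj₁ m'          = outside-new WC z∉H out m'
    ... | inj₂ (here refl) = g∉H
    shape : NonSimpleShape H u (step g s t z ∷ C ++ back)
    shape = g , s , t , t , s , z , q , qs , refl , z∉H , closed , uC , g∉C

  -- Leaving V(H) through g from u to z, followed by a ditrail from z back
  -- to V(H) which traverses g again: if g is traversed from u to z, the
  -- part after g is a ditrail continuing g; otherwise the part before g is
  -- a closed ditrail at z.
  ear-revisiting : ∀ {u z g s t y τ} T₁ a b p T₂ → g ∈ E G → g ∉ E H → Joins G g u z
                 → TravOK G g u z s t → u ∈ V H → z ∉ V H
                 → DiTrail G (- t) τ z y (T₁ ++ step g a b p ∷ T₂) → y ∈ V H → NewEar
  ear-revisiting {u} {z} {g} {s} {t} {y} T₁ a b p T₂ g∈G g∉H J Tr u∈H z∉H (W , uT , end , hT) y∈H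
    with split-diwalk T₁ W | unique-edges-++⁻ T₁ (step g a b p ∷ T₂) uT
  ... | W₁ , cons _ J' Tr' c' W₂ | u₁ , u₂ , disjoint with orientation {G} J (separated u∈H z∉H) J'
  ... | inj₁ (_ , p≡z) =
    trail-ear T₂ u∈H z∉H g∉H (cons g∈G J Tr (subst (λ σ → Compat σ T₂) b≡t c') (subst (λ w → DiWalk G w T₂) p≡z W₂))
              u₂ (subst (λ w → lastV w T₂ ∈ V H) p≡z (subst (_∈ V H) (sym end') y∈H))
    where
    b≡t : b ≡ t
    b≡t = sign-unique {G} g∈G (joins-sym {G} J) (λ eq → separated u∈H z∉H (sym eq))
                      (subst (λ w → w ∈ ∂ G b g) p≡z (proj₁ (proj₂ Tr'))) (proj₁ (proj₂ Tr))
    end' : lastV p T₂ ≡ y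
    end' = trans (sym (lastV-++ z T₁ (step g a b p ∷ T₂))) end
  ... | inj₂ (start≡z , _) with split-type T₁ W hT
  ... | β , γ , hT₁ , (a≡γ , _) , γ≡ =
    closed-ear T₁ g∈G J Tr u∈H z∉H g∉H W₁ (subst (HasType T₁ (- t)) β≡-t hT₁) start≡z u₁
               (λ m → disjoint (m , here refl))
    where
    a≡t : a ≡ t
    a≡t = sign-unique {G} g∈G (joins-sym {G} J) (λ eq → separated u∈H z∉H (sym eq))
                      (subst (λ w → w ∈ ∂ G a g) start≡z (proj₁ Tr')) (proj₁ (proj₂ Tr))
    β≡-t : β ≡ - t
    β≡-t = trans (sym (-‿involutive β)) (cong -_ (trans (sym γ≡) (trans (sym a≡γ) a≡t)))

  ear-along-trail : ∀ {u z g s t y τ} T → g ∈ E G → g ∉ E H → Joins G g u z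
                  → TravOK G g u z s t → u ∈ V H → z ∉ V H
                  → DiTrail G (- t) τ z y T → y ∈ V H → NewEar
  ear-along-trail [] _ _ _ _ _ z∉H (_ , _ , refl , _) y∈H = ⊥-elim (z∉H y∈H)
  ear-along-trail {g = g} {t = t} {y} T@(_ ∷ _) g∈G g∉H J Tr u∈H z∉H Tt@(W , uT , end , hT) y∈H
    with g ∈? edges T
  ... | no g∉T =
    trail-ear T u∈H z∉H g∉H (cons g∈G J Tr (λ eq → σ≢-σ t (trans eq (proj₁ hT))) W)
              (unique-∷ g∉T uT) (subst (_∈ V H) (sym end) y∈H)
  ... | yes g∈T with split-at-edge T g∈T
  ... | T₁ , a , b , p , T₂ , eq =
    ear-revisiting T₁ a b p T₂ g∈G g∉H J Tr u∈H z∉H (subst (DiTrail G (- t) _ _ y) eq Tt) y∈H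

  crossing : ∀ x ss → DiWalk G x ss → x ∉ V H → lastV x ss ∈ V H → BoundaryEdge
  crossing x []                  _                      x∉H end∈H = ⊥-elim (x∉H end∈H)
  crossing x (step e a b w ∷ ts) (cons e∈G J Tr _ W) x∉H end∈H with w ∈? V H
  ... | yes w∈H = e , w , x , e∈G , leaves-outside Tr x∉H , w∈H , joins-sym {G} J
  ... | no w∉H  = crossing w ts W w∉H end∈H

  module _ (α : Sign) (r : ℕ) (r∈H : r ∈ V H) (reach : ∀ {v} → v ∈ V G → Reaches α r G v) where

    -- a new edge with an end outside V(H) leads to the boundary along a
    -- ditrail to r
    boundary-edge : ∀ {f} → f ∈ E G → f ∉ E H → BoundaryEdge
    boundary-edge {f} f∈G f∉H with ends G f∈G
    ... | u , z , I , _ with u ∈? V H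
    ... | yes u∈H = f , u , z , f∈G , f∉H , u∈H , I
    ... | no u∉H with end-sign {G} (from (I u) (inj₁ refl))
    ... | σ , u∈σ with reach (∂⊆V G f∈G σ u∈σ) α
    ... | ss , W , _ , end , _ = crossing u ss W u∉H (subst (_∈ V H) (sym end) r∈H)

    ear-exists : ∀ {f} → f ∈ E G → f ∉ E H → NewEar
    ear-exists f∈G f∉H with boundary-edge f∈G f∉H
    ... | g , u , z , g∈G , g∉H , u∈H , J with traversal {G} J | z ∈? V H
    ... | s , t , Tr | yes z∈H =
      u , step g s t z , [] ,
      (cons g∈G J Tr tt (nil (proj₁ H⊆G z∈H)) , u∈H , z∈H , λ { (here refl) → g∉H }) , inj₁ ([] ∷ [])
    ... | s , t , Tr | no z∉H with reach (∂⊆V G g∈G t (proj₁ (proj₂ Tr))) (- t)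
    ...   | T , Tt = ear-along-trail T g∈G g∉H J Tr u∈H z∉H Tt r∈H

count-outside : List ℕ → List ℕ → ℕ
count-outside A []       = 0
count-outside A (x ∷ xs) with x ∈? A
... | yes _ = count-outside A xs
... | no  _ = suc (count-outside A xs)

count-outside-mono : ∀ {A B} → (∀ {e} → e ∈ A → e ∈ B) → ∀ L → count-outside B L ≤ count-outside A L
count-outside-mono sub [] = z≤n
count-outside-mono {A} {B} sub (x ∷ xs) with x ∈? A | x ∈? B
... | yes _   | yes _  = count-outside-mono sub xs
... | yes x∈A | no x∉B = ⊥-elim (x∉B (sub x∈A))
... | no _    | yes _  = m≤n⇒m≤1+n (count-outside-mono sub xs)
... | no _    | no _   = s≤s (count-outside-mono sub xs)

count-outside-< : ∀ {A B} → (∀ {e} → e ∈ A → e ∈ B) → ∀ L {f} → f ∈ L → f ∉ A → f ∈ B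
                → count-outside B L < count-outside A L
count-outside-< {A} {B} sub (x ∷ xs) (here refl) x∉A x∈B with x ∈? A | x ∈? B
... | yes x∈A | _      = ⊥-elim (x∉A x∈A)
... | no _    | no x∉B = ⊥-elim (x∉B x∈B)
... | no _    | yes _  = s≤s (count-outside-mono sub xs)
count-outside-< {A} {B} sub (x ∷ xs) (there f∈) f∉A f∈B with x ∈? A | x ∈? B
... | yes _   | yes _  = count-outside-< sub xs f∈ f∉A f∈B
... | yes x∈A | no x∉B = ⊥-elim (x∉B (sub x∈A))
... | no _    | yes _  = m≤n⇒m≤1+n (count-outside-< sub xs f∈ f∉A f∈B)
... | no _    | no _   = s≤s (count-outside-< sub xs f∈ f∉A f∈B)

module Completeness (α : Sign) (r : ℕ) (G : Graph) (strong : StrongRadial α r G) where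

  reach : ∀ {v} → v ∈ V G → Reaches α r G v
  reach = strong⇒reaches strong

  missing : Graph → ℕ
  missing H = count-outside (E H) (E G)

  -- a subgraph containing r and every edge of G contains every vertex of
  -- G, since each vertex is r or the start of an edge of a ditrail to r
  covers-vertices : ∀ {H} → H ⊆G G → r ∈ V H → (∀ {e} → e ∈ E G → e ∈ E H)
                  → ∀ {v} → v ∈ V G → v ∈ V H
  covers-vertices {H} (_ , _ , s∂) r∈H all v∈G with reach v∈G α
  ... | []                , _                              , _ , refl , _ = r∈H
  ... | step e σ _ _ ∷ _ , cons e∈G _ (v∈∂ , _) _ _ , _ , _    , _ =
    ∂⊆V H (all e∈G) σ (from (s∂ (all e∈G) σ _) v∈∂)

  grow : ∀ H → 𝒜 α r H → H ⊆G G → r ∈ V H → Acc _<_ (missing H) → 𝒜 α r G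
  grow H A H⊆G r∈H (acc smaller) with all? (_∈? E H) (E G)
  ... | yes all = 𝒜-resp-same A H⊆G (covers-vertices {H} H⊆G r∈H (All.lookup all)) (All.lookup all)
  ... | no ¬all with find (¬All⇒Any¬ (_∈? E H) (E G) ¬all)
  ... | f , f∈G , f∉H with EarFinding.ear-exists H G H⊆G α r r∈H reach f∈G f∉H
  ... | u , t , ss , D@((W , _ , _ , new) , _) =
    grow H' (ear A H⊆G D H'-ok) (proj₁ H'-ok) (∈-++⁺ˡ r∈H) (smaller fewer)
    where
    H' : Graph
    H' = plus-graph H G H⊆G u (t ∷ ss) W
    H'-ok : IsPlus H G u (t ∷ ss) H'
    H'-ok = plus-graph-ok H G H⊆G u (t ∷ ss) W
    fewer : missing H' < missing H
    fewer = count-outside-< ∈-++⁺ˡ (E G) (walk-edges W (here refl)) (new (here refl))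
                            (∈-++⁺ʳ (E H) (here refl))

  -- start from a (-α,-α)-ditrail closed over r, which exists as G is strong
  completeness : 𝒜 α r G
  completeness with proj₂ strong (proj₁ (proj₁ strong))
  ... | ss , T@(W , _) =
    grow (walk-graph G r ss W) (base T H₀-ok) (proj₁ H₀-ok) (here refl) (<-wellFounded _)
    where
    H₀-ok : IsWalkGraph G r ss (walk-graph G r ss W)
    H₀-ok = walk-graph-ok G r ss W

theorem9p4 : (r : ℕ) (α : Sign) (G : Graph) → (𝒜 α r G ⇔ StrongRadial α r G)
theorem9p4 r α G = mk⇔ (λ A → rooted⇒strong (Soundness.soundness α r A)) (Completeness.completeness α r G)
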